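{- For positive integers $c,p$, the graph $H_{c,p}$ (with its cyclic ample framing) has $p^{c+1}-p$ good non-exceptional routes.
   Context: $H_{c,p}$ has vertex set $\{0,\dots,c+1\}\times\{1,\dots,p\}$ and edges $(a,b)\to(a+1,b)$ for $0\le a\le c$ and $(a,b)\to(a,b+1\bmod p)$ for $1\le a\le c$; its cyclic ample framing colours the cycle edges $(a,b)\to(a,b+1)$ red and the other edges blue. A route that is a directed walk from a source $(0,b)$ to a sink $(c+1,b')$ is good if it does not traverse all edges of one of the $p$-cycles consecutively. Two routes $\rho,\rho'$ are incompatible if both are source-to-sink walks and there is a common subwalk $S$ (possibly a vertex) with $\rho=PSQ$, $\rho'=P'SQ'$, last edge of $P$ and first edge of $Q'$ blue, first edge of $Q$ and last edge of $P'$ red; a route (cycle or walk) is exceptional if compatible with every route. -}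

module Defs where

open import Data.Nat using (ℕ; zero; suc; _≤_; _^_; _∸_)
open import Data.Fin using (Fin; toℕ; fromℕ)
open import Data.Empty using (⊥)
open import Data.Product using (_×_; Σ; ∃; ∃-syntax; _,_; proj₁)
open import Data.Sum using (_⊎_)
open import Data.List using (List; []; _∷_; _++_; length)
open import Data.List.NonEmpty using (List⁺; head; last; toList) renaming (_∷_ to _∷⁺_)
import Data.Fin as Fin
open import Data.List.Relation.Unary.All using (All)
open import Data.List.Relation.Unary.Linked using (Linked)
open import Relation.Binary.PropositionalEquality using (_≡_)
open import Relation.Nullary using (¬_)

-- The graph H_{c,p}.  Layers a ∈ {0,…,c+1} are Fin (2 + c); the cyclic
-- coordinate b ∈ {1,…,p} is represented by Fin p (i.e. b-1 ∈ {0,…,p-1}).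
module _ (c p : ℕ) where

  Vertex : Set
  Vertex = Fin (suc (suc c)) × Fin p

  layer : Vertex → Fin (suc (suc c))
  layer = proj₁

  CycSucc : Fin p → Fin p → Set
  CycSucc b b' = (suc (toℕ b) ≡ toℕ b') ⊎ (suc (toℕ b) ≡ p × toℕ b' ≡ 0)

  BlueEdge : Vertex → Vertex → Set
  BlueEdge (a , b) (a' , b') = toℕ a' ≡ suc (toℕ a) × toℕ a ≤ c × b ≡ b'

  RedEdge : Vertex → Vertex → Set
  RedEdge (a , b) (a' , b') = a ≡ a' × 1 ≤ toℕ a × toℕ a ≤ c × CycSucc b b'

  -- H_{c,p} is simple (no parallel edges), so a directed edge is a pair of
  -- vertices and a directed walk is its (nonempty) list of vertices.
  Edge : Vertex → Vertex → Set
  Edge u v = BlueEdge u v ⊎ RedEdge u v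

  IsRoute : List Vertex → Set
  IsRoute [] = ⊥
  IsRoute (v ∷ vs) =
    Linked Edge (v ∷ vs) × layer v ≡ Fin.zero
    × layer (last (v ∷⁺ vs)) ≡ fromℕ (suc c)

  -- ρ traverses all edges of the p-cycle in layer a consecutively: there is a
  -- contiguous segment S of ρ staying in layer a (hence consisting of
  -- consecutive edges of that cycle) in which every edge (a,b) → (a,b+1) of
  -- the cycle occurs.
  TraversesCycle : List Vertex → Fin (suc (suc c)) → Set
  TraversesCycle ρ a =
    ∃[ P ] ∃[ S ] ∃[ Q ] (ρ ≡ P ++ S ++ Q × All (λ v → layer v ≡ a) S
      × (∀ b b' → CycSucc b b' →
           ∃[ S₁ ] ∃[ S₂ ] (S ≡ S₁ ++ (a , b) ∷ (a , b') ∷ S₂)))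

  Good : List Vertex → Set
  Good ρ = IsRoute ρ
         × (∀ a → 1 ≤ toℕ a → toℕ a ≤ c → ¬ TraversesCycle ρ a)

  -- ρ = P S Q, ρ' = P' S Q', S a common subwalk (possibly a single vertex);
  -- x, y are the last vertex of P and first of Q (so (x , head S) is the last
  -- edge of P and (last S , y) the first edge of Q); similarly x', y'.
  IncompatibleOrdered : List Vertex → List Vertex → Set
  IncompatibleOrdered ρ ρ' =
    IsRoute ρ × IsRoute ρ' ×
    ∃[ P ] ∃[ x ] ∃[ S ] ∃[ y ] ∃[ Q ] ∃[ P' ] ∃[ x' ] ∃[ y' ] ∃[ Q' ]
      ( ρ ≡ P ++ x ∷ toList S ++ y ∷ Q
      × ρ' ≡ P' ++ x' ∷ toList S ++ y' ∷ Q'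
      × BlueEdge x (head S) × RedEdge (last S) y
      × RedEdge x' (head S) × BlueEdge (last S) y' )

  Incompatible : List Vertex → List Vertex → Set
  Incompatible ρ ρ' = IncompatibleOrdered ρ ρ' ⊎ IncompatibleOrdered ρ' ρ

  -- exceptional: compatible with every route.  Incompatibility only holds
  -- between source-to-sink walks, so it suffices to range over vertex lists.
  Exceptional : List Vertex → Set
  Exceptional ρ = ∀ ρ' → ¬ Incompatible ρ ρ'

-- A route is determined by its source (0, b) and the numbers kₐ of red steps it makes in the
-- layers a = 1, …, c.  It is good iff every kₐ < p: p consecutive red steps in layer a run once
-- round its p-cycle, whereas fewer than p steps along the cycle cover fewer than p of its edges
-- (pigeonhole).  A route with all kₐ = 0 uses blue edges only, so no route is incompatible with
-- it.  If kₐ > 0, the route enters layer a at some (a, t) by a blue edge and leaves it by a red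
-- one, while the route from (0, t − 1) whose only red step is (a, t − 1) → (a, t) enters (a, t)
-- by a red edge and leaves it by a blue one: the two are incompatible along S = (a, t).  Hence
-- the good non-exceptional routes correspond to the p (pᶜ − 1) pairs (b, k) with
-- k ∈ {0, …, p − 1}ᶜ ∖ {0}.

module Submission where

open import Defs
open import Data.Nat using (ℕ; zero; suc; _≤_; _<_; _^_; _∸_; _+_; _*_; z≤n; s≤s; z<s; _%_; NonZero)
open import Data.Nat.Properties
open import Data.Nat.DivMod
  using (_mod_; m%n<n; n%n≡0; m<n⇒m%n≡m; m≤n⇒m%n≡m; m%n%n≡m%n; %-distribˡ-+; [m+n]%n≡m%n)
open import Data.Fin as Fin using (Fin; toℕ; fromℕ; fromℕ<; inject₁)
open import Data.Fin.Properties
  using (pigeonhole; toℕ-injective; toℕ-fromℕ; toℕ-fromℕ<; toℕ<n; toℕ≤pred[n]; toℕ-inject₁)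
open import Data.Product using (_×_; _,_; proj₁; proj₂; ∃; ∃₂; ∃-syntax; uncurry)
open import Data.Sum using (_⊎_; inj₁; inj₂)
open import Data.Empty using (⊥-elim)
open import Data.List
  using (List; []; _∷_; _++_; length; map; cartesianProductWith; cartesianProduct; upTo; allFin)
import Data.List as List
open import Data.List.Properties
  using (∷-injective; ∷-injectiveˡ; ∷-injectiveʳ; ++-assoc;
         length-++; length-map; length-upTo; length-tabulate)
open import Data.List.NonEmpty using (last; toList) renaming (_∷_ to _∷⁺_)
open import Data.List.Membership.Propositional using (_∈_; _∉_)
open import Data.List.Membership.Propositional.Properties
  using (∈-++⁺ˡ; ∈-++⁺ʳ; ∈-++⁻; ∈-map⁺; ∈-map⁻; ∈-upTo⁺; ∈-upTo⁻; ∈-allFin;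
         ∈-cartesianProductWith⁺; ∈-cartesianProductWith⁻; ∈-cartesianProduct⁺; ∈-cartesianProduct⁻)
open import Data.List.Relation.Unary.Any using (here; there)
import Data.List.Relation.Unary.All as ListAll
open import Data.List.Relation.Unary.AllPairs using ([])
open import Data.List.Relation.Unary.Linked as Linked using (Linked; []; [-]; _∷_)
open import Data.List.Relation.Unary.Unique.Propositional using (Unique)
open import Data.List.Relation.Unary.Unique.Propositional.Properties
  using (++⁺; map⁺; cartesianProductWith⁺; cartesianProduct⁺; allFin⁺; upTo⁺)
open import Data.Vec using (Vec; []; _∷_; replicate)
import Data.Vec.Properties as Vec
open import Data.Vec.Relation.Unary.All using (All; []; _∷_)
open import Function using (case_of_; _∘_; id)
open import Function.Bundles using (_⇔_; mk⇔)
open import Relation.Binary.PropositionalEquality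
open import Relation.Nullary using (¬_; yes; no)

last-∷ : ∀ {A : Set} (x y : A) ys → last (x ∷⁺ y ∷ ys) ≡ last (y ∷⁺ ys)
last-∷ x y ys with List.initLast ys
... | List.[] = refl
... | _ List.∷ʳ′ _ = refl

module _ {A : Set} where

  Adjacent : A → A → List A → Set
  Adjacent x y xs = ∃₂ λ X Y → xs ≡ X ++ x ∷ y ∷ Y

  adjacent-∷⁺ : ∀ {x y z zs} → Adjacent x y zs → Adjacent x y (z ∷ zs)
  adjacent-∷⁺ {z = z} (X , Y , eq) = z ∷ X , Y , cong (z ∷_) eq

  adjacent-∷⁻ : ∀ {x y z zs} → Adjacent x y (z ∷ zs) → x ≡ z ⊎ Adjacent x y zs
  adjacent-∷⁻ ([] , Y , refl) = inj₁ refl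
  adjacent-∷⁻ (_ ∷ X , Y , eq) = inj₂ (X , Y , ∷-injectiveʳ eq)

  adjacent-∷⇒∈ : ∀ {x y z zs} → Adjacent x y (z ∷ zs) → y ∈ zs
  adjacent-∷⇒∈ ([] , Y , refl) = here refl
  adjacent-∷⇒∈ (_ ∷ X , Y , eq) = subst (_ ∈_) (sym (∷-injectiveʳ eq)) (∈-++⁺ʳ X (there (here refl)))

  adjacent-++⁺ : ∀ {x y} P {S} Q → Adjacent x y S → Adjacent x y (P ++ S ++ Q)
  adjacent-++⁺ {x} {y} P Q (S₁ , S₂ , refl) = P ++ S₁ , S₂ ++ Q , (begin
    P ++ (S₁ ++ x ∷ y ∷ S₂) ++ Q    ≡⟨ cong (P ++_) (++-assoc S₁ (x ∷ y ∷ S₂) Q) ⟩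
    P ++ S₁ ++ x ∷ y ∷ S₂ ++ Q      ≡⟨ ++-assoc P S₁ _ ⟨
    (P ++ S₁) ++ x ∷ y ∷ S₂ ++ Q    ∎)
    where open ≡-Reasoning

  record PassesThrough (R S : A → A → Set) (xs : List A) (u : A) : Set where
    constructor passesThrough
    field
      {before after} : A
      prefix suffix : List A
      split : xs ≡ prefix ++ before ∷ u ∷ after ∷ suffix
      enter : R before u
      leave : S u after

  passesThrough-∷⁺ : ∀ {R S xs u} z → PassesThrough R S xs u → PassesThrough R S (z ∷ xs) u
  passesThrough-∷⁺ z (passesThrough P Q eq r s) = passesThrough (z ∷ P) Q (cong (z ∷_) eq) r s

module _ {A : Set} {R : A → A → Set} where

  linked-++⁻ʳ : ∀ xs {ys} → Linked R (xs ++ ys) → Linked R ys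
  linked-++⁻ʳ [] l = l
  linked-++⁻ʳ (x ∷ xs) l = linked-++⁻ʳ xs (Linked.tail l)

  linked-last : ∀ h t {y Q} → Linked R (h ∷ t ++ y ∷ Q) → R (last (h ∷⁺ t)) y
  linked-last h [] l = Linked.head l
  linked-last h (h' ∷ t) {y} l =
    subst (λ z → R z y) (sym (last-∷ h h' t)) (linked-last h' t (Linked.tail l))

length-cartesianProductWith : ∀ {A B C : Set} (f : A → B → C) xs ys →
                              length (cartesianProductWith f xs ys) ≡ length xs * length ys
length-cartesianProductWith f [] ys = refl
length-cartesianProductWith f (x ∷ xs) ys = begin
  length (map (f x) ys ++ cartesianProductWith f xs ys)
    ≡⟨ length-++ (map (f x) ys) ⟩
  length (map (f x) ys) + length (cartesianProductWith f xs ys)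
    ≡⟨ cong₂ _+_ (length-map (f x) ys) (length-cartesianProductWith f xs ys) ⟩
  length ys + length xs * length ys
    ∎
  where open ≡-Reasoning

¬cover-by-fewer : ∀ {n k} → k < n → (g : ℕ → Fin n) → ¬ (∀ b → ∃ λ i → i < k × g i ≡ b)
¬cover-by-fewer k<n g cover with pigeonhole k<n (λ b → fromℕ< (proj₁ (proj₂ (cover b))))
... | b , b' , b<b' , same = <⇒≢ b<b' (cong toℕ (begin
  b                       ≡⟨ proj₂ (proj₂ (cover b)) ⟨
  g (proj₁ (cover b))     ≡⟨ cong g (trans (sym (toℕ-fromℕ< _)) (trans (cong toℕ same) (toℕ-fromℕ< _))) ⟩
  g (proj₁ (cover b'))    ≡⟨ proj₂ (proj₂ (cover b')) ⟩
  b'                      ∎))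
  where open ≡-Reasoning

module _ (d : ℕ) .{{_ : NonZero d}} where

  %-absorbˡ : ∀ m n → (m % d + n) % d ≡ (m + n) % d
  %-absorbˡ m n = begin
    (m % d + n) % d             ≡⟨ %-distribˡ-+ (m % d) n d ⟩
    (m % d % d + n % d) % d     ≡⟨ cong (λ x → (x + n % d) % d) (m%n%n≡m%n m d) ⟩
    (m % d + n % d) % d         ≡⟨ %-distribˡ-+ m n d ⟨
    (m + n) % d                 ∎
    where open ≡-Reasoning

  %-absorbʳ : ∀ m n → (m + n % d) % d ≡ (m + n) % d
  %-absorbʳ m n = begin
    (m + n % d) % d   ≡⟨ cong (_% d) (+-comm m (n % d)) ⟩
    (n % d + m) % d   ≡⟨ %-absorbˡ n m ⟩
    (n + m) % d       ≡⟨ cong (_% d) (+-comm n m) ⟩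
    (m + n) % d       ∎
    where open ≡-Reasoning

≤-of-+ : ∀ {n a m} → n + a ≡ m → a ≤ m
≤-of-+ {n} {a} e = subst (a ≤_) e (m≤n+m a n)

module H (c p′ : ℕ) where

  p : ℕ
  p = suc p′

  next : Fin p → Fin p
  next b = suc (toℕ b) mod p

  toℕ-next : ∀ b → toℕ (next b) ≡ suc (toℕ b) % p
  toℕ-next b = toℕ-fromℕ< (m%n<n (suc (toℕ b)) p)

  toℕ-cycSucc : ∀ {b b'} → CycSucc c p b b' → toℕ b' ≡ suc (toℕ b) % p
  toℕ-cycSucc {b' = b'} (inj₁ e) = sym (trans (cong (_% p) e) (m<n⇒m%n≡m (toℕ<n b')))
  toℕ-cycSucc (inj₂ (e , z)) = trans z (sym (trans (cong (_% p) e) (n%n≡0 p)))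

  cycSucc⇒≡next : ∀ {b b'} → CycSucc c p b b' → b' ≡ next b
  cycSucc⇒≡next {b} cs = toℕ-injective (trans (toℕ-cycSucc cs) (sym (toℕ-next b)))

  cycSucc-next : ∀ b → CycSucc c p b (next b)
  cycSucc-next b with m≤n⇒m<n∨m≡n (toℕ<n b)
  ... | inj₁ b+1<p = inj₁ (sym (trans (toℕ-next b) (m<n⇒m%n≡m b+1<p)))
  ... | inj₂ b+1≡p = inj₂ (b+1≡p , trans (toℕ-next b) (trans (cong (_% p) b+1≡p) (n%n≡0 p)))

  prev : Fin p → Fin p
  prev Fin.zero = fromℕ p′
  prev (Fin.suc i) = inject₁ i

  next-prev : ∀ t → next (prev t) ≡ t
  next-prev t = sym (cycSucc⇒≡next (cycSucc-prev t))
    where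
    cycSucc-prev : ∀ t → CycSucc c p (prev t) t
    cycSucc-prev Fin.zero = inj₂ (cong suc (toℕ-fromℕ p′) , refl)
    cycSucc-prev (Fin.suc i) = inj₁ (cong suc (toℕ-inject₁ i))

  iter : ℕ → Fin p → Fin p
  iter zero s = s
  iter (suc i) s = iter i (next s)

  iter-suc : ∀ i s → iter (suc i) s ≡ next (iter i s)
  iter-suc zero s = refl
  iter-suc (suc i) s = iter-suc i (next s)

  toℕ-iter : ∀ i s → toℕ (iter i s) ≡ (toℕ s + i) % p
  toℕ-iter zero s = sym (trans (cong (_% p) (+-identityʳ (toℕ s))) (m<n⇒m%n≡m (toℕ<n s)))
  toℕ-iter (suc i) s = begin
    toℕ (iter i (next s))         ≡⟨ toℕ-iter i (next s) ⟩
    (toℕ (next s) + i) % p        ≡⟨ cong (λ x → (x + i) % p) (toℕ-next s) ⟩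
    (suc (toℕ s) % p + i) % p     ≡⟨ %-absorbˡ p (suc (toℕ s)) i ⟩
    (suc (toℕ s) + i) % p         ≡⟨ cong (_% p) (+-suc (toℕ s) i) ⟨
    (toℕ s + suc i) % p           ∎
    where open ≡-Reasoning

  iter-surjective : ∀ s b → ∃ λ i → i < p × iter i s ≡ b
  iter-surjective s b = i , m%n<n (p ∸ toℕ s + toℕ b) p , toℕ-injective (begin
    toℕ (iter i s)                       ≡⟨ toℕ-iter i s ⟩
    (toℕ s + i) % p                      ≡⟨ %-absorbʳ p (toℕ s) (p ∸ toℕ s + toℕ b) ⟩
    (toℕ s + (p ∸ toℕ s + toℕ b)) % p    ≡⟨ cong (_% p) (sym (+-assoc (toℕ s) _ (toℕ b))) ⟩
    (toℕ s + (p ∸ toℕ s) + toℕ b) % p    ≡⟨ cong (λ x → (x + toℕ b) % p) (m+[n∸m]≡n (<⇒≤ (toℕ<n s))) ⟩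
    (p + toℕ b) % p                      ≡⟨ cong (_% p) (+-comm p (toℕ b)) ⟩
    (toℕ b + p) % p                      ≡⟨ [m+n]%n≡m%n (toℕ b) p ⟩
    toℕ b % p                            ≡⟨ m<n⇒m%n≡m (toℕ<n b) ⟩
    toℕ b                                ∎)
    where
    open ≡-Reasoning
    i : ℕ
    i = (p ∸ toℕ s + toℕ b) % p

  Vx : Set
  Vx = Vertex c p

  -- vx a s is the vertex (a, s + 1) of the paper; level a = a mod (c + 2) is the intended layer
  -- only for a ≤ c + 1.

  level : ℕ → Fin (suc (suc c))
  level a = a mod suc (suc c)

  vx : ℕ → Fin p → Vx
  vx a s = level a , s

  toℕ-level : ∀ {a} → a ≤ suc c → toℕ (level a) ≡ a
  toℕ-level {a} h = trans (toℕ-fromℕ< (m%n<n a (suc (suc c)))) (m≤n⇒m%n≡m h)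

  level-toℕ : ∀ α → level (toℕ α) ≡ α
  level-toℕ α = toℕ-injective (toℕ-level (toℕ≤pred[n] α))

  level-injective : ∀ {a a'} → a ≤ suc c → a' ≤ suc c → level a ≡ level a' → a ≡ a'
  level-injective h h' e = trans (sym (toℕ-level h)) (trans (cong toℕ e) (toℕ-level h'))

  level≢sink : ∀ {a} → a ≤ c → level a ≢ fromℕ (suc c)
  level≢sink {a} h e = 1+n≰n (subst (_≤ c) (level-injective (m≤n⇒m≤1+n h) ≤-refl eq) h)
    where
    eq : level a ≡ level (suc c)
    eq = trans e (toℕ-injective (trans (toℕ-fromℕ (suc c)) (sym (toℕ-level ≤-refl))))

  vx-below : ∀ {a a' u t} → a < a' → a' ≤ suc c → vx a u ≢ vx a' t
  vx-below a<a' h eq = <⇒≢ a<a' (level-injective (<⇒≤ (<-≤-trans a<a' h)) h (cong proj₁ eq))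

  blue : ∀ {a} s → a ≤ c → BlueEdge c p (vx a s) (vx (suc a) s)
  blue s h = trans (toℕ-level (s≤s h)) (cong suc (sym (toℕ-level (m≤n⇒m≤1+n h)))) ,
             subst (_≤ c) (sym (toℕ-level (m≤n⇒m≤1+n h))) h , refl

  red : ∀ {a} s → 1 ≤ a → a ≤ c → RedEdge c p (vx a s) (vx a (next s))
  red s h₁ h = refl , subst (1 ≤_) (sym (toℕ-level (m≤n⇒m≤1+n h))) h₁ ,
               subst (_≤ c) (sym (toℕ-level (m≤n⇒m≤1+n h))) h , cycSucc-next s

  blue-target : ∀ {a s w} → a ≤ suc c → BlueEdge c p (vx a s) w → w ≡ vx (suc a) s
  blue-target {w = l , _} h (e , _ , refl) =
    cong (_, _) (trans (sym (level-toℕ l)) (cong level (trans e (cong suc (toℕ-level h)))))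

  red-target : ∀ {a s w} → RedEdge c p (vx a s) w → w ≡ vx a (next s)
  red-target {a} {w = _ , _} (refl , _ , _ , cs) = cong (vx a) (cycSucc⇒≡next cs)

  blue⇒¬red : ∀ {x y} → BlueEdge c p x y → ¬ RedEdge c p x y
  blue⇒¬red {_ , _} {_ , _} (e , _) (refl , _) = 1+n≢n (sym e)

  last-layer-∷ : ∀ x y ys → layer c p (last (x ∷⁺ y ∷ ys)) ≡ layer c p (last (y ∷⁺ ys))
  last-layer-∷ x y ys = cong (layer c p) (last-∷ x y ys)

  sink-has-no-edge : ∀ {s w} → ¬ Edge c p (vx (suc c) s) w
  sink-has-no-edge (inj₁ (_ , h , _)) = 1+n≰n (subst (_≤ c) (toℕ-level ≤-refl) h)
  sink-has-no-edge (inj₂ (_ , _ , h , _)) = 1+n≰n (subst (_≤ c) (toℕ-level ≤-refl) h)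

  -- Routes as vectors of turn counts

  mutual
    climb : ∀ {n} → ℕ → Fin p → Vec ℕ n → List Vx
    climb a s [] = vx a s ∷ []
    climb a s (k ∷ ks) = circle a s k ks

    circle : ∀ {n} → ℕ → Fin p → ℕ → Vec ℕ n → List Vx
    circle a s zero ks = vx a s ∷ climb (suc a) s ks
    circle a s (suc k) ks = vx a s ∷ circle a (next s) k ks

  route : Fin p → Vec ℕ c → List Vx
  route b ks = vx 0 b ∷ climb 1 b ks

  circle-∷ : ∀ {n} a s k (ks : Vec ℕ n) → ∃ λ T → circle a s k ks ≡ vx a s ∷ T
  circle-∷ a s zero ks = _ , refl
  circle-∷ a s (suc k) ks = _ , refl

  climb-∷ : ∀ {n} a s (ks : Vec ℕ n) → ∃ λ T → climb a s ks ≡ vx a s ∷ T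
  climb-∷ a s [] = _ , refl
  climb-∷ a s (k ∷ ks) = circle-∷ a s k ks

  mutual
    climb-linked : ∀ {n a s x} (ks : Vec ℕ n) → n + a ≡ suc c → 1 ≤ a →
                   Edge c p x (vx a s) → Linked (Edge c p) (x ∷ climb a s ks)
    climb-linked [] _ _ e = e ∷ [-]
    climb-linked {suc n} {a} (k ∷ ks) inv h e = circle-linked k ks (trans (+-suc n a) inv) h e

    circle-linked : ∀ {n a s x} k (ks : Vec ℕ n) → n + suc a ≡ suc c → 1 ≤ a →
                    Edge c p x (vx a s) → Linked (Edge c p) (x ∷ circle a s k ks)
    circle-linked {s = s} zero ks inv h e =
      e ∷ climb-linked ks inv (s≤s z≤n) (inj₁ (blue s (≤-pred (≤-of-+ inv))))
    circle-linked {s = s} (suc k) ks inv h e =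
      e ∷ circle-linked k ks inv h (inj₂ (red s h (≤-pred (≤-of-+ inv))))

  mutual
    climb-last : ∀ {n a s} x (ks : Vec ℕ n) → n + a ≡ suc c →
                 layer c p (last (x ∷⁺ climb a s ks)) ≡ fromℕ (suc c)
    climb-last x [] refl = toℕ-injective (trans (toℕ-level ≤-refl) (sym (toℕ-fromℕ (suc c))))
    climb-last {suc n} {a} x (k ∷ ks) inv = circle-last x k ks (trans (+-suc n a) inv)

    circle-last : ∀ {n a s} x k (ks : Vec ℕ n) → n + suc a ≡ suc c →
                  layer c p (last (x ∷⁺ circle a s k ks)) ≡ fromℕ (suc c)
    circle-last {a = a} {s} x zero ks inv =
      trans (last-layer-∷ x (vx a s) (climb (suc a) s ks)) (climb-last {a = suc a} {s} (vx a s) ks inv)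
    circle-last {a = a} {s} x (suc k) ks inv =
      trans (last-layer-∷ x (vx a s) (circle a (next s) k ks))
            (circle-last {a = a} {next s} (vx a s) k ks inv)

  route-isRoute : ∀ b ks → IsRoute c p (route b ks)
  route-isRoute b ks =
    climb-linked ks (+-comm c 1) ≤-refl (inj₁ (blue b z≤n)) , refl , climb-last (vx 0 b) ks (+-comm c 1)

  climb≢circle : ∀ {n m a s t} k (ks : Vec ℕ n) (ks' : Vec ℕ m) → a ≤ c →
                 climb (suc a) s ks ≢ circle a t k ks'
  climb≢circle {a = a} {s} {t} k ks ks' h eq with climb-∷ (suc a) s ks | circle-∷ a t k ks'
  ... | _ , eq₁ | _ , eq₂ = vx-below ≤-refl (s≤s h) (sym (∷-injectiveˡ (trans (sym eq₁) (trans eq eq₂))))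

  mutual
    climb-injective : ∀ {n a s s'} (ks ks' : Vec ℕ n) → n + a ≡ suc c →
                      climb a s ks ≡ climb a s' ks' → ks ≡ ks'
    climb-injective [] [] _ _ = refl
    climb-injective {suc n} {a} (k ∷ ks) (k' ∷ ks') inv eq
      with refl , refl ← circle-injective k k' ks ks' (trans (+-suc n a) inv) eq = refl

    circle-injective : ∀ {n a s s'} k k' (ks ks' : Vec ℕ n) → n + suc a ≡ suc c →
                       circle a s k ks ≡ circle a s' k' ks' → k ≡ k' × ks ≡ ks'
    circle-injective zero zero ks ks' inv eq = refl , climb-injective ks ks' inv (∷-injectiveʳ eq)
    circle-injective zero (suc k') ks ks' inv eq =
      ⊥-elim (climb≢circle k' ks ks' (≤-pred (≤-of-+ inv)) (∷-injectiveʳ eq))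
    circle-injective (suc k) zero ks ks' inv eq =
      ⊥-elim (climb≢circle k ks' ks (≤-pred (≤-of-+ inv)) (sym (∷-injectiveʳ eq)))
    circle-injective (suc k) (suc k') ks ks' inv eq
      with refl , refl ← circle-injective k k' ks ks' inv (∷-injectiveʳ eq) = refl , refl

  route-injective : ∀ {b b' ks ks'} → route b ks ≡ route b' ks' → (b , ks) ≡ (b' , ks')
  route-injective eq with refl , eq' ← ∷-injective eq = cong (_ ,_) (climb-injective _ _ (+-comm c 1) eq')

  mutual
    climb-surjective : ∀ {n a s} rest → n + a ≡ suc c → Linked (Edge c p) (vx a s ∷ rest) →
                       layer c p (last (vx a s ∷⁺ rest)) ≡ fromℕ (suc c) →
                       ∃ λ (ks : Vec ℕ n) → vx a s ∷ rest ≡ climb a s ks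
    climb-surjective {zero} [] _ _ _ = [] , refl
    climb-surjective {zero} (w ∷ rest) refl (e ∷ _) _ = ⊥-elim (sink-has-no-edge e)
    climb-surjective {suc n} {a} rest inv L ends
      with k , ks , eq ← circle-surjective rest (trans (+-suc n a) inv) L ends = k ∷ ks , eq

    circle-surjective : ∀ {n a s} rest → n + suc a ≡ suc c → Linked (Edge c p) (vx a s ∷ rest) →
                        layer c p (last (vx a s ∷⁺ rest)) ≡ fromℕ (suc c) →
                        ∃₂ λ k (ks : Vec ℕ n) → vx a s ∷ rest ≡ circle a s k ks
    circle-surjective [] inv _ ends = ⊥-elim (level≢sink (≤-pred (≤-of-+ inv)) ends)
    circle-surjective {a = a} {s} (w ∷ rest) inv (inj₁ e ∷ L) ends
      with refl ← blue-target (m≤n⇒m≤1+n (≤-pred (≤-of-+ inv))) e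
      with ks , eq ← climb-surjective rest inv L (trans (sym (last-layer-∷ (vx a s) w rest)) ends)
      = 0 , ks , cong (vx a s ∷_) eq
    circle-surjective {a = a} {s} (w ∷ rest) inv (inj₂ e ∷ L) ends
      with refl ← red-target {a} {s} e
      with k , ks , eq ← circle-surjective rest inv L (trans (sym (last-layer-∷ (vx a s) w rest)) ends)
      = suc k , ks , cong (vx a s ∷_) eq

  route-surjective : ∀ ρ → IsRoute c p ρ → ∃₂ λ b ks → ρ ≡ route b ks
  route-surjective ((_ , b) ∷ []) (_ , refl , ())
  route-surjective ((_ , b) ∷ w ∷ rest) (inj₁ e ∷ L , refl , ends)
    with refl ← blue-target z≤n e
    with ks , eq ← climb-surjective rest (+-comm c 1) L (trans (sym (last-layer-∷ (vx 0 b) w rest)) ends)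
    = b , ks , cong (vx 0 b ∷_) eq
  route-surjective ((_ , b) ∷ w ∷ rest) (inj₂ (_ , () , _) ∷ _ , refl , _)

  -- Good routes: fewer than p turns in every layer

  orbit : ℕ → Fin p → ℕ → List Vx
  orbit a s zero = vx a s ∷ []
  orbit a s (suc m) = vx a s ∷ orbit a (next s) m

  orbit-in-layer : ∀ a s m → ListAll.All (λ x → layer c p x ≡ level a) (orbit a s m)
  orbit-in-layer a s zero = refl ListAll.∷ ListAll.[]
  orbit-in-layer a s (suc m) = refl ListAll.∷ orbit-in-layer a (next s) m

  orbit-adjacent : ∀ a s {m i} → i < m → Adjacent (vx a (iter i s)) (vx a (iter (suc i) s)) (orbit a s m)
  orbit-adjacent a s {suc zero} {zero} _ = [] , [] , refl
  orbit-adjacent a s {suc (suc m)} {zero} _ = [] , _ , refl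
  orbit-adjacent a s {suc m} {suc i} (s≤s i<m) = adjacent-∷⁺ (orbit-adjacent a (next s) i<m)

  orbit-covers : ∀ a s {b b'} → CycSucc c p b b' → Adjacent (vx a b) (vx a b') (orbit a s p)
  orbit-covers a s {b} cs with refl ← cycSucc⇒≡next cs | i , i<p , refl ← iter-surjective s b =
    subst (λ t → Adjacent (vx a (iter i s)) (vx a t) (orbit a s p)) (iter-suc i s) (orbit-adjacent a s i<p)

  circle-orbit : ∀ {n} a s {m} k (ks : Vec ℕ n) → m ≤ k → ∃ λ T → circle a s k ks ≡ orbit a s m ++ T
  circle-orbit a s {zero} k ks _ = circle-∷ a s k ks
  circle-orbit a s {suc m} (suc k) ks (s≤s m≤k) with T , eq ← circle-orbit a (next s) k ks m≤k =
    T , cong (vx a s ∷_) eq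

  circle-traverses : ∀ {n} a s k (ks : Vec ℕ n) → p ≤ k → TraversesCycle c p (circle a s k ks) (level a)
  circle-traverses a s k ks p≤k with T , eq ← circle-orbit a s k ks p≤k =
    [] , orbit a s p , T , eq , orbit-in-layer a s p , λ _ _ cs → orbit-covers a s cs

  TraversesNoCycle : List Vx → Set
  TraversesNoCycle ρ = ∀ α → 1 ≤ toℕ α → toℕ α ≤ c → ¬ TraversesCycle c p ρ α

  traversesNoCycle-∷⁻ : ∀ {x ρ} → TraversesNoCycle (x ∷ ρ) → TraversesNoCycle ρ
  traversesNoCycle-∷⁻ {x} none α h₁ h₂ (P , S , Q , eq , rest) =
    none α h₁ h₂ (x ∷ P , S , Q , cong (x ∷_) eq , rest)

  mutual
    climb-bounded : ∀ {n a s} (ks : Vec ℕ n) → n + a ≡ suc c → 1 ≤ a →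
                    TraversesNoCycle (climb a s ks) → All (_< p) ks
    climb-bounded [] _ _ _ = []
    climb-bounded {suc n} {a} {s} (k ∷ ks) inv 1≤a none =
      ≰⇒> (λ p≤k → none (level a) (subst (1 ≤_) (sym (toℕ-level a≤1+c)) 1≤a)
                                  (subst (_≤ c) (sym (toℕ-level a≤1+c)) a≤c)
                                  (circle-traverses a s k ks p≤k))
      ∷ circle-bounded k ks inv′ none
      where
      inv′ : n + suc a ≡ suc c
      inv′ = trans (+-suc n a) inv
      a≤c : a ≤ c
      a≤c = ≤-pred (≤-of-+ inv′)
      a≤1+c : a ≤ suc c
      a≤1+c = m≤n⇒m≤1+n a≤c

    circle-bounded : ∀ {n a s} k (ks : Vec ℕ n) → n + suc a ≡ suc c →
                     TraversesNoCycle (circle a s k ks) → All (_< p) ks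
    circle-bounded zero ks inv none = climb-bounded ks inv (s≤s z≤n) (traversesNoCycle-∷⁻ none)
    circle-bounded (suc k) ks inv none = circle-bounded k ks inv (traversesNoCycle-∷⁻ none)

  route-bounded : ∀ {b ks} → Good c p (route b ks) → All (_< p) ks
  route-bounded good = climb-bounded _ (+-comm c 1) ≤-refl (traversesNoCycle-∷⁻ (proj₂ good))

  ShortOrbitIn : List Vx → ℕ → Set
  ShortOrbitIn ρ a =
    ∃₂ λ s k → k < p × ∀ {u w} → Adjacent (vx a u) (vx a w) ρ → ∃ λ i → i < k × iter i s ≡ u

  shortOrbit⇒¬traverses : ∀ {ρ a} → ShortOrbitIn ρ a → ¬ TraversesCycle c p ρ (level a)
  shortOrbit⇒¬traverses (s , k , k<p , steps) (P , S , Q , eq , _ , covers) =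
    ¬cover-by-fewer k<p (λ i → iter i s) λ b →
      steps (subst (Adjacent _ _) (sym eq) (adjacent-++⁺ P Q (covers b (next b) (cycSucc-next b))))

  shortOrbitIn-∷ : ∀ {ρ a a' t} → a' < a → a ≤ suc c → ShortOrbitIn ρ a → ShortOrbitIn (vx a' t ∷ ρ) a
  shortOrbitIn-∷ a'<a h (s , k , k<p , steps) = s , k , k<p , λ adj → case adjacent-∷⁻ adj of λ where
    (inj₁ eq) → ⊥-elim (vx-below a'<a h (sym eq))
    (inj₂ adj') → steps adj'

  mutual
    climb-above : ∀ {n a a' u t} (ks : Vec ℕ n) → n + a' ≡ suc c → a < a' → vx a u ∉ climb a' t ks
    climb-above [] inv a<a' (here eq) = vx-below a<a' (≤-of-+ inv) eq
    climb-above {suc n} {a' = a'} (k ∷ ks) inv = circle-above k ks (trans (+-suc n a') inv)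

    circle-above : ∀ {n a a' u t} k (ks : Vec ℕ n) → n + suc a' ≡ suc c → a < a' →
                   vx a u ∉ circle a' t k ks
    circle-above zero ks inv a<a' (here eq) = vx-below a<a' (m≤n⇒m≤1+n (≤-pred (≤-of-+ inv))) eq
    circle-above zero ks inv a<a' (there m) = climb-above ks inv (m≤n⇒m≤1+n a<a') m
    circle-above (suc k) ks inv a<a' (here eq) = vx-below a<a' (m≤n⇒m≤1+n (≤-pred (≤-of-+ inv))) eq
    circle-above (suc k) ks inv a<a' (there m) = circle-above k ks inv a<a' m

  circle-steps : ∀ {n a s u w} k (ks : Vec ℕ n) → n + suc a ≡ suc c →
                 Adjacent (vx a u) (vx a w) (circle a s k ks) → ∃ λ i → i < k × iter i s ≡ u
  circle-steps zero ks inv adj = ⊥-elim (climb-above ks inv ≤-refl (adjacent-∷⇒∈ adj))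
  circle-steps (suc k) ks inv adj with adjacent-∷⁻ adj
  ... | inj₁ eq = 0 , s≤s z≤n , sym (cong proj₂ eq)
  ... | inj₂ adj' with i , i<k , eq ← circle-steps k ks inv adj' = suc i , s≤s i<k , eq

  mutual
    climb-short : ∀ {n a s α} (ks : Vec ℕ n) → n + a ≡ suc c → All (_< p) ks → a ≤ α → α ≤ c →
                  ShortOrbitIn (climb a s ks) α
    climb-short [] refl [] a≤α α≤c = ⊥-elim (1+n≰n (≤-trans a≤α α≤c))
    climb-short {suc n} {a} (k ∷ ks) inv (k<p ∷ ks<p) = circle-short k ks (trans (+-suc n a) inv) k<p ks<p

    circle-short : ∀ {n a s α} k (ks : Vec ℕ n) → n + suc a ≡ suc c → k < p → All (_< p) ks →
                   a ≤ α → α ≤ c → ShortOrbitIn (circle a s k ks) α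
    circle-short {s = s} k ks inv k<p ks<p a≤α α≤c with m≤n⇒m<n∨m≡n a≤α
    ... | inj₂ refl = s , k , k<p , circle-steps k ks inv
    ... | inj₁ a<α = circle-short-above k ks inv ks<p a<α α≤c

    circle-short-above : ∀ {n a s α} k (ks : Vec ℕ n) → n + suc a ≡ suc c → All (_< p) ks →
                         a < α → α ≤ c → ShortOrbitIn (circle a s k ks) α
    circle-short-above {a = a} {s} {α} zero ks inv ks<p a<α α≤c =
      shortOrbitIn-∷ {a = α} {a} {s} a<α (m≤n⇒m≤1+n α≤c) (climb-short ks inv ks<p a<α α≤c)
    circle-short-above {a = a} {s} {α} (suc k) ks inv ks<p a<α α≤c =
      shortOrbitIn-∷ {a = α} {a} {s} a<α (m≤n⇒m≤1+n α≤c) (circle-short-above k ks inv ks<p a<α α≤c)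

  route-traversesNoCycle : ∀ b ks → All (_< p) ks → TraversesNoCycle (route b ks)
  route-traversesNoCycle b ks ks<p α 1≤α α≤c =
    subst (¬_ ∘ TraversesCycle c p (route b ks)) (level-toℕ α) (shortOrbit⇒¬traverses {a = toℕ α} short)
    where
    short : ShortOrbitIn (route b ks) (toℕ α)
    short = shortOrbitIn-∷ {a = toℕ α} {0} {b} 1≤α (m≤n⇒m≤1+n α≤c)
                           (climb-short ks (+-comm c 1) ks<p 1≤α α≤c)

  -- Exceptional routes: no turns at all

  blue⇒exceptional : ∀ ρ → Linked (BlueEdge c p) ρ → Exceptional c p ρ
  blue⇒exceptional ρ blue ρ'
    (inj₁ (_ , _ , P , _ , h ∷⁺ t , _ , _ , _ , _ , _ , _ , eq , _ , _ , red , _ , _)) =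
    blue⇒¬red (linked-last h t (Linked.tail (linked-++⁻ʳ P (subst (Linked _) eq blue)))) red
  blue⇒exceptional ρ blue ρ'
    (inj₂ (_ , _ , _ , _ , _ ∷⁺ _ , _ , _ , P , _ , _ , _ , _ , eq , _ , _ , red , _)) =
    blue⇒¬red (Linked.head (linked-++⁻ʳ P (subst (Linked _) eq blue))) red

  climb-zeros-blue : ∀ {n a s x} → n + a ≡ suc c → BlueEdge c p x (vx a s) →
                     Linked (BlueEdge c p) (x ∷ climb a s (replicate n 0))
  climb-zeros-blue {zero} _ e = e ∷ [-]
  climb-zeros-blue {suc n} {a} {s} inv e =
    e ∷ climb-zeros-blue {n} {suc a} inv′ (blue s (≤-pred (≤-of-+ inv′)))
    where
    inv′ : n + suc a ≡ suc c
    inv′ = trans (+-suc n a) inv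

  route-zeros-exceptional : ∀ b → Exceptional c p (route b (replicate c 0))
  route-zeros-exceptional b = blue⇒exceptional _ (climb-zeros-blue {c} {1} (+-comm c 1) (blue b z≤n))

  BlueThenRed RedThenBlue : List Vx → Vx → Set
  BlueThenRed = PassesThrough (BlueEdge c p) (RedEdge c p)
  RedThenBlue = PassesThrough (RedEdge c p) (BlueEdge c p)

  incompatible-at : ∀ {ρ ρ' u} → IsRoute c p ρ → IsRoute c p ρ' →
                    BlueThenRed ρ u → RedThenBlue ρ' u → Incompatible c p ρ ρ'
  incompatible-at {u = u} r r' (passesThrough {x} {y} P Q eq bx ry)
                               (passesThrough {x'} {y'} P' Q' eq' rx' by') =
    inj₁ (r , r' , P , x , u ∷⁺ [] , y , Q , P' , x' , y' , Q' , eq , eq' , bx , ry , rx' , by')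

  circle-zero-blueThenRed : ∀ {n a s} (ks : Vec ℕ n) → n + suc a ≡ suc c → ks ≢ replicate n 0 →
                            ∃₂ λ i t → i < c × BlueThenRed (circle a s 0 ks) (vx (suc i) t)
  circle-zero-blueThenRed [] _ ks≢0 = ⊥-elim (ks≢0 refl)
  circle-zero-blueThenRed {suc n} {a} {s} (zero ∷ ks) inv ks≢0
    with i , t , i<c , through ← circle-zero-blueThenRed ks (trans (+-suc n (suc a)) inv) (ks≢0 ∘ cong (0 ∷_))
    = i , t , i<c , passesThrough-∷⁺ (vx a s) through
  circle-zero-blueThenRed {suc n} {a} {s} (suc k ∷ ks) inv _ with T , eq ← circle-∷ (suc a) (next s) k ks =
    a , s , a<c ,
    passesThrough [] T (cong (λ R → vx a s ∷ vx (suc a) s ∷ R) eq) (blue s (<⇒≤ a<c)) (red s (s≤s z≤n) a<c)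
    where
    a<c : a < c
    a<c = ≤-of-+ (suc-injective inv)

  pulse : ℕ → (n : ℕ) → Vec ℕ n
  pulse _ zero = []
  pulse zero (suc n) = 1 ∷ replicate n 0
  pulse (suc i) (suc n) = 0 ∷ pulse i n

  climb-pulse-redThenBlue : ∀ {n a} s i → i < n → n + a ≡ suc c → 1 ≤ a →
                            RedThenBlue (climb a s (pulse i n)) (vx (i + a) (next s))
  climb-pulse-redThenBlue {suc n} {a} s zero _ inv 1≤a with T , eq ← climb-∷ (suc a) (next s) (replicate n 0) =
    passesThrough [] T (cong (λ R → vx a s ∷ vx a (next s) ∷ R) eq) (red s 1≤a a≤c) (blue (next s) a≤c)
    where
    a≤c : a ≤ c
    a≤c = ≤-pred (≤-of-+ (trans (+-suc n a) inv))
  climb-pulse-redThenBlue {suc n} {a} s (suc i) (s≤s i<n) inv 1≤a =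
    subst (λ a' → RedThenBlue (climb a s (pulse (suc i) (suc n))) (vx a' (next s))) (+-suc i a)
          (passesThrough-∷⁺ (vx a s) (climb-pulse-redThenBlue s i i<n (trans (+-suc n a) inv) (s≤s z≤n)))

  route-nonzero-¬exceptional : ∀ b ks → ks ≢ replicate c 0 → ¬ Exceptional c p (route b ks)
  route-nonzero-¬exceptional b ks ks≢0 exceptional
    -- route b ks unfolds to circle 0 b 0 ks
    with i , t , i<c , blueRed ← circle-zero-blueThenRed {a = 0} {b} ks (+-comm c 1) ks≢0 =
    exceptional ρ' (incompatible-at (route-isRoute b ks) (route-isRoute (prev t) (pulse i c)) blueRed redBlue)
    where
    ρ' : List Vx
    ρ' = route (prev t) (pulse i c)
    redBlue : RedThenBlue ρ' (vx (suc i) t)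
    redBlue = subst₂ (λ a t' → RedThenBlue ρ' (vx a t')) (+-comm i 1) (next-prev t)
                (passesThrough-∷⁺ (vx 0 (prev t)) (climb-pulse-redThenBlue (prev t) i i<c (+-comm c 1) ≤-refl))

  -- A nonzero vector has either a nonzero tail, or a zero tail and a nonzero head.
  nonzeroTurns : (n : ℕ) → List (Vec ℕ n)
  nonzeroTurns zero = []
  nonzeroTurns (suc n) =
    cartesianProductWith _∷_ (upTo p) (nonzeroTurns n) ++ map (λ k → suc k ∷ replicate n 0) (upTo p′)

  replicate-bounded : ∀ n → All (_< p) (replicate n 0)
  replicate-bounded zero = []
  replicate-bounded (suc n) = z<s ∷ replicate-bounded n

  ∈-nonzeroTurns⁺ : ∀ {n} (ks : Vec ℕ n) → All (_< p) ks → ks ≢ replicate n 0 → ks ∈ nonzeroTurns n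
  ∈-nonzeroTurns⁺ [] [] ks≢0 = ⊥-elim (ks≢0 refl)
  ∈-nonzeroTurns⁺ {suc n} (k ∷ ks) (k<p ∷ ks<p) k∷ks≢0 with Vec.≡-dec _≟_ ks (replicate n 0) | k
  ... | no ks≢0 | _ = ∈-++⁺ˡ (∈-cartesianProductWith⁺ _∷_ (∈-upTo⁺ k<p) (∈-nonzeroTurns⁺ ks ks<p ks≢0))
  ... | yes refl | zero = ⊥-elim (k∷ks≢0 refl)
  ... | yes refl | suc j = ∈-++⁺ʳ _ (∈-map⁺ (λ k → suc k ∷ replicate n 0) (∈-upTo⁺ (≤-pred k<p)))

  ∈-nonzeroTurns⁻ : ∀ {n} {ks : Vec ℕ n} → ks ∈ nonzeroTurns n → All (_< p) ks × ks ≢ replicate n 0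
  ∈-nonzeroTurns⁻ {suc n} ks∈ with ∈-++⁻ (cartesianProductWith _∷_ (upTo p) (nonzeroTurns n)) ks∈
  ... | inj₁ ks∈ˡ
    with k , ks , k∈ , ks∈ , refl ← ∈-cartesianProductWith⁻ _∷_ (upTo p) (nonzeroTurns n) ks∈ˡ
    with ks<p , ks≢0 ← ∈-nonzeroTurns⁻ ks∈
    = ∈-upTo⁻ k∈ ∷ ks<p , ks≢0 ∘ Vec.∷-injectiveʳ
  ... | inj₂ ks∈ʳ with j , j∈ , refl ← ∈-map⁻ (λ k → suc k ∷ replicate n 0) ks∈ʳ =
    s≤s (∈-upTo⁻ j∈) ∷ replicate-bounded n , λ ()

  nonzeroTurns-unique : ∀ n → Unique (nonzeroTurns n)
  nonzeroTurns-unique zero = []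
  nonzeroTurns-unique (suc n) =
    ++⁺ (cartesianProductWith⁺ _∷_ Vec.∷-injective (upTo⁺ p) (nonzeroTurns-unique n))
        (map⁺ (suc-injective ∘ Vec.∷-injectiveˡ) (upTo⁺ p′)) disjoint
    where
    disjoint : ∀ {ks} → ¬ (ks ∈ cartesianProductWith _∷_ (upTo p) (nonzeroTurns n) ×
                           ks ∈ map (λ k → suc k ∷ replicate n 0) (upTo p′))
    disjoint (ks∈ˡ , ks∈ʳ)
      with _ , _ , _ , ks∈ , refl ← ∈-cartesianProductWith⁻ _∷_ (upTo p) (nonzeroTurns n) ks∈ˡ
         | _ , _ , eq ← ∈-map⁻ (λ k → suc k ∷ replicate n 0) ks∈ʳ
      = proj₂ (∈-nonzeroTurns⁻ ks∈) (Vec.∷-injectiveʳ eq)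

  suc-length-nonzeroTurns : ∀ n → suc (length (nonzeroTurns n)) ≡ p ^ n
  suc-length-nonzeroTurns zero = refl
  suc-length-nonzeroTurns (suc n) = begin
    suc (length (cartesianProductWith _∷_ (upTo p) (nonzeroTurns n) ++ map _ (upTo p′)))
      ≡⟨ cong suc (length-++ (cartesianProductWith _∷_ (upTo p) (nonzeroTurns n))) ⟩
    suc (length (cartesianProductWith _∷_ (upTo p) (nonzeroTurns n)) + length (map _ (upTo p′)))
      ≡⟨ cong suc (cong₂ _+_ (length-cartesianProductWith _∷_ (upTo p) (nonzeroTurns n))
                             (length-map _ (upTo p′))) ⟩
    suc (length (upTo p) * L + length (upTo p′))
      ≡⟨ cong₂ (λ x y → suc (x * L + y)) (length-upTo p) (length-upTo p′) ⟩
    suc (p * L + p′)   ≡⟨ +-suc (p * L) p′ ⟨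
    p * L + p          ≡⟨ +-comm (p * L) p ⟩
    p + p * L          ≡⟨ *-suc p L ⟨
    p * suc L          ≡⟨ cong (p *_) (suc-length-nonzeroTurns n) ⟩
    p * p ^ n          ∎
    where
    open ≡-Reasoning
    L = length (nonzeroTurns n)

  routes : List (List Vx)
  routes = map (uncurry route) (cartesianProduct (allFin p) (nonzeroTurns c))

  routes-unique : Unique routes
  routes-unique = map⁺ route-injective (cartesianProduct⁺ (allFin⁺ p) (nonzeroTurns-unique c))

  length-routes : length routes ≡ p ^ suc c ∸ p
  length-routes = begin
    length routes
      ≡⟨ length-map (uncurry route) (cartesianProduct (allFin p) (nonzeroTurns c)) ⟩
    length (cartesianProduct (allFin p) (nonzeroTurns c))
      ≡⟨ length-cartesianProductWith _,_ (allFin p) (nonzeroTurns c) ⟩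
    length (allFin p) * L    ≡⟨ cong (_* L) (length-tabulate {n = p} id) ⟩
    p * L                    ≡⟨ m+n∸m≡n p (p * L) ⟨
    p + p * L ∸ p            ≡⟨ cong (_∸ p) (*-suc p L) ⟨
    p * suc L ∸ p            ≡⟨ cong (λ x → p * x ∸ p) (suc-length-nonzeroTurns c) ⟩
    p ^ suc c ∸ p            ∎
    where
    open ≡-Reasoning
    L = length (nonzeroTurns c)

  ∈-routes⁺ : ∀ {ρ} → Good c p ρ → ¬ Exceptional c p ρ → ρ ∈ routes
  ∈-routes⁺ good ¬exceptional with b , ks , refl ← route-surjective _ (proj₁ good) =
    ∈-map⁺ (uncurry route) (∈-cartesianProduct⁺ (∈-allFin b) (∈-nonzeroTurns⁺ ks (route-bounded good) ks≢0))
    where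
    ks≢0 : ks ≢ replicate c 0
    ks≢0 refl = ¬exceptional (route-zeros-exceptional b)

  ∈-routes⁻ : ∀ {ρ} → ρ ∈ routes → Good c p ρ × ¬ Exceptional c p ρ
  ∈-routes⁻ ρ∈ with (b , ks) , bks∈ , refl ← ∈-map⁻ (uncurry route) ρ∈
    with ks<p , ks≢0 ← ∈-nonzeroTurns⁻ (proj₂ (∈-cartesianProduct⁻ (allFin p) (nonzeroTurns c) bks∈)) =
    (route-isRoute b ks , route-traversesNoCycle b ks ks<p) , route-nonzero-¬exceptional b ks ks≢0

proposition8p2 : (c p : ℕ) → 1 ≤ c → 1 ≤ p →
    ∃[ L ] ( Unique L
           × (∀ ρ → (ρ ∈ L) ⇔ (Good c p ρ × ¬ Exceptional c p ρ))
           × length L ≡ p ^ suc c ∸ p )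
proposition8p2 c (suc p′) _ _ =
  routes , routes-unique , (λ _ → mk⇔ ∈-routes⁻ (uncurry ∈-routes⁺)) , length-routes
  where open H c p′
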